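{- If $G=(X,Y;E)$ is a bipartite graph (without multiple edges) with maximum degree $\Delta(G)$, then $$\chi'_{int}(G,X) \leq \frac{(\Delta(G))^2(\Delta(G)+1)}{2}.$$
   Context: For a bipartite graph $G$ with parts $X$ and $Y$, an $X$-interval coloring is a proper edge coloring of $G$ by integers such that, for every vertex $x\in X$, the set of colors on the edges incident to $x$ forms an interval of consecutive integers. $\chi'_{int}(G,X)$ denotes the smallest integer $t$ such that $G$ has an $X$-interval coloring using $t$ colors (every bipartite graph has one, e.g. with $|E(G)|$ colors). -}

module Defs where

open import Data.Nat using (ℕ; zero; suc; _+_; _*_; _≤_; _⊔_)
open import Data.Nat.DivMod using (_/_)
open import Data.Bool using (Bool; true; false; if_then_else_)
open import Data.Fin using (Fin)
open import Data.List using (List; foldr; map; length; filter)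
open import Data.List.Base using (allFin)
open import Data.Product using (Σ; _×_; ∃; ∃-syntax)
open import Relation.Binary.PropositionalEquality using (_≡_; _≢_)
open import Relation.Nullary.Decidable using (does)

-- A finite simple bipartite graph G = (X, Y; E) with X = Fin m, Y = Fin n.
-- Adjacency is a Bool-valued relation, so there are no multiple edges.
record BipGraph (m n : ℕ) : Set where
  field
    adj : Fin m → Fin n → Bool

open BipGraph public

Edge : ∀ {m n} → BipGraph m n → Fin m → Fin n → Set
Edge G x y = adj G x y ≡ true

count : ∀ {k} → (Fin k → Bool) → ℕ
count {k} p = foldr (λ i acc → if p i then suc acc else acc) 0 (allFin k)

degX : ∀ {m n} → BipGraph m n → Fin m → ℕ
degX G x = count (λ y → adj G x y)

degY : ∀ {m n} → BipGraph m n → Fin n → ℕ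
degY G y = count (λ x → adj G x y)

maxOver : ∀ {k} → (Fin k → ℕ) → ℕ
maxOver {k} f = foldr (λ i acc → f i ⊔ acc) 0 (allFin k)

Δ : ∀ {m n} → BipGraph m n → ℕ
Δ G = maxOver (degX G) ⊔ maxOver (degY G)

-- Values of c on non-edges are irrelevant.
record IsXIntervalColoring {m n : ℕ} (G : BipGraph m n) (t : ℕ)
                           (c : Fin m → Fin n → ℕ) : Set where
  field
    inRange     : ∀ x y → Edge G x y → 1 ≤ c x y × c x y ≤ t
    properX     : ∀ x y₁ y₂ → Edge G x y₁ → Edge G x y₂ → y₁ ≢ y₂ → c x y₁ ≢ c x y₂
    properY     : ∀ y x₁ x₂ → Edge G x₁ y → Edge G x₂ y → x₁ ≢ x₂ → c x₁ y ≢ c x₂ y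
    intervalX   : ∀ x y₁ y₂ k → Edge G x y₁ → Edge G x y₂ →
                  c x y₁ ≤ k → k ≤ c x y₂ → ∃[ y ] (Edge G x y × c x y ≡ k)

HasXIntervalColoring : ∀ {m n} → BipGraph m n → ℕ → Set
HasXIntervalColoring G t = Σ (Fin _ → Fin _ → ℕ) (IsXIntervalColoring G t)

-- χ'_int(G, X) ≤ B  (χ'_int is the least t admitting such a coloring)
χ'int≤ : ∀ {m n} → BipGraph m n → ℕ → Set
χ'int≤ G B = ∃[ t ] (t ≤ B × HasXIntervalColoring G t)

{-# OPTIONS --safe #-}
-- Colour the vertices of X one at a time. A new vertex of degree d receives the
-- consecutive colours k+1, …, k+d on its edges (neighbours taken in increasing order),
-- which is an interval there. Its edge to a neighbour y clashes with an earlier edge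
-- x'y only if k is one of the at most Δ−1 numbers c(x'y) − 1 − (position of y), so at
-- most d(Δ−1) values of k are forbidden and, by pigeonhole, some k ≤ d(Δ−1) is free.
-- Every colour is then at most d(Δ−1) + d ≤ Δ² ≤ Δ²(Δ+1)/2.
module Submission where

open import Defs
open import Data.Nat using (ℕ; _+_; _*_)
open import Data.Nat.DivMod using (_/_)

open import Data.Nat using (zero; suc; pred; _∸_; _≤_; _<_; z≤n; s≤s; _⊔_)
open import Data.Nat.Properties
open import Data.Nat.DivMod using (m*n/n≡m; /-monoˡ-≤)
open import Data.Bool using (Bool; true; false; if_then_else_)
open import Data.Empty using (⊥-elim)
open import Data.Fin using (Fin; zero; suc; toℕ)
open import Data.Fin.Properties using (toℕ≤pred[n]; ¬∀⟶∃¬; pigeonhole)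
open import Data.List
  using (List; []; [_]; _++_; length; foldr; map; concat; tabulate; lookup; allFin)
open import Data.List.Properties using (length-++; map-tabulate; foldr-map)
open import Data.List.Relation.Unary.Any using (here; index)
open import Data.List.Relation.Unary.Any.Properties using (lookup-index)
open import Data.List.Membership.Propositional using (_∈_; _∉_)
open import Data.List.Membership.Propositional.Properties using (∈-concat⁺′; ∈-tabulate⁺)
open import Data.List.Membership.DecPropositional _≟_ using (_∈?_)
open import Data.Product using (_×_; _,_; ∃-syntax)
open import Data.Vec.Functional using (_∷_)
open import Function using (_∘_; id)
open import Relation.Binary.PropositionalEquality
  using (_≡_; _≢_; refl; sym; trans; cong; subst; module ≡-Reasoning)
open import Relation.Nullary using (¬_)

foldr-allFin-suc : ∀ {A : Set} {k} (f : Fin (suc k) → A → A) e →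
                   foldr f e (allFin (suc k)) ≡ f zero (foldr (f ∘ suc) e (allFin k))
foldr-allFin-suc {k = k} f e = cong (f zero) (begin
  foldr f e (tabulate suc)         ≡⟨ cong (foldr f e) (sym (map-tabulate id suc)) ⟩
  foldr f e (map suc (allFin k))   ≡⟨ foldr-map f suc e (allFin k) ⟩
  foldr (f ∘ suc) e (allFin k)     ∎)
  where open ≡-Reasoning

count-suc : ∀ {k} (p : Fin (suc k) → Bool) →
            count p ≡ (if p zero then suc (count (p ∘ suc)) else count (p ∘ suc))
count-suc p = foldr-allFin-suc (λ i acc → if p i then suc acc else acc) 0

count-suc-≤ : ∀ {k} (p : Fin (suc k) → Bool) → count (p ∘ suc) ≤ count p
count-suc-≤ p rewrite count-suc p with p zero
... | true  = n≤1+n _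
... | false = ≤-refl

count-suc-true : ∀ {k} (p : Fin (suc k) → Bool) → p zero ≡ true →
                 suc (count (p ∘ suc)) ≡ count p
count-suc-true p p₀ rewrite count-suc p | p₀ = refl

≤-maxOver : ∀ {k} (f : Fin k → ℕ) i → f i ≤ maxOver f
≤-maxOver {suc k} f i rewrite foldr-allFin-suc (λ j acc → f j ⊔ acc) 0 with i
... | zero  = m≤m⊔n _ _
... | suc j = ≤-trans (≤-maxOver (f ∘ suc) j) (m≤n⊔m _ _)

degX≤Δ : ∀ {m n} (G : BipGraph m n) x → degX G x ≤ Δ G
degX≤Δ G x = ≤-trans (≤-maxOver (degX G) x) (m≤m⊔n _ _)

degY≤Δ : ∀ {m n} (G : BipGraph m n) y → degY G y ≤ Δ G
degY≤Δ G y = ≤-trans (≤-maxOver (degY G) y) (m≤n⊔m _ _)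

rank : ∀ {k} → (Fin k → Bool) → Fin k → ℕ
rank p zero    = 0
rank p (suc y) = if p zero then suc (rank (p ∘ suc) y) else rank (p ∘ suc) y

rank-suc : ∀ {k} (p : Fin (suc k) → Bool) {b} → p zero ≡ b → ∀ y →
           rank p (suc y) ≡ (if b then suc (rank (p ∘ suc) y) else rank (p ∘ suc) y)
rank-suc p refl y = refl

rank<count : ∀ {k} (p : Fin k → Bool) y → p y ≡ true → rank p y < count p
rank<count p zero    py rewrite count-suc p | py = s≤s z≤n
rank<count p (suc y) py rewrite count-suc p with p zero
... | true  = s≤s (rank<count (p ∘ suc) y py)
... | false = rank<count (p ∘ suc) y py

rank-injective : ∀ {k} (p : Fin k → Bool) {y₁ y₂} → p y₁ ≡ true → p y₂ ≡ true →
                 rank p y₁ ≡ rank p y₂ → y₁ ≡ y₂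
rank-injective p {zero}   {zero}   _   _   _ = refl
rank-injective p {zero}   {suc _}  py₁ _   eq rewrite py₁ with () ← eq
rank-injective p {suc _}  {zero}   _   py₂ eq rewrite py₂ with () ← eq
rank-injective p {suc y₁} {suc y₂} py₁ py₂ eq with p zero
... | true  = cong suc (rank-injective (p ∘ suc) py₁ py₂ (suc-injective eq))
... | false = cong suc (rank-injective (p ∘ suc) py₁ py₂ eq)

rank-surjective : ∀ {k} (p : Fin k → Bool) j → j < count p →
                  ∃[ y ] (p y ≡ true × rank p y ≡ j)
rank-surjective {suc k} p j j<count rewrite count-suc p with p zero in p₀
rank-surjective {suc k} p zero    _             | true = zero , p₀ , refl
rank-surjective {suc k} p (suc j) (s≤s j<count) | true
  with y , py , refl ← rank-surjective (p ∘ suc) j j<count =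
  suc y , py , rank-suc p p₀ y
rank-surjective {suc k} p j j<count | false
  with y , py , refl ← rank-surjective (p ∘ suc) j j<count =
  suc y , py , rank-suc p p₀ y

∈-if-true : ∀ {A : Set} {b} {xs : List A} {a} → b ≡ true → a ∈ xs → a ∈ (if b then xs else [])
∈-if-true refl a∈xs = a∈xs

length-concat-if-≤ : ∀ {A : Set} {k} (q : Fin k → Bool) (g : Fin k → List A) {B} →
                     (∀ i → q i ≡ true → length (g i) ≤ B) →
                     length (concat (tabulate λ i → if q i then g i else [])) ≤ count q * B
length-concat-if-≤ {k = zero}  q g bound = z≤n
length-concat-if-≤ {k = suc k} q g {B} bound rewrite count-suc q with q zero in q₀
... | true  = begin
  length (g zero ++ rest)       ≡⟨ length-++ (g zero) ⟩
  length (g zero) + length rest ≤⟨ +-mono-≤ (bound zero q₀) restBound ⟩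
  B + count (q ∘ suc) * B       ∎
  where
  open ≤-Reasoning
  rest = concat (tabulate λ i → if q (suc i) then g (suc i) else [])
  restBound = length-concat-if-≤ (q ∘ suc) (g ∘ suc) (bound ∘ suc)
... | false = length-concat-if-≤ (q ∘ suc) (g ∘ suc) (bound ∘ suc)

¬∀i≤length-∈ : (ℓ : List ℕ) → ¬ (∀ (i : Fin (suc (length ℓ))) → toℕ i ∈ ℓ)
¬∀i≤length-∈ ℓ ∈ℓ with i , j , i<j , samePos ← pigeonhole ≤-refl (index ∘ ∈ℓ) =
  <⇒≢ i<j (begin
    toℕ i                   ≡⟨ lookup-index (∈ℓ i) ⟩
    lookup ℓ (index (∈ℓ i)) ≡⟨ cong (lookup ℓ) samePos ⟩
    lookup ℓ (index (∈ℓ j)) ≡⟨ lookup-index (∈ℓ j) ⟨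
    toℕ j                   ∎)
  where open ≡-Reasoning

∃-∉-≤length : (ℓ : List ℕ) → ∃[ k ] (k ≤ length ℓ × k ∉ ℓ)
∃-∉-≤length ℓ with i , i∉ℓ ← ¬∀⟶∃¬ _ (λ i → toℕ i ∈ ℓ) (λ i → toℕ i ∈? ℓ) (¬∀i≤length-∈ ℓ) =
  toℕ i , toℕ≤pred[n] i , i∉ℓ

1+k+r≤D*D : ∀ {k r d D} → k ≤ d * (D ∸ 1) → r < d → d ≤ D → suc (k + r) ≤ D * D
1+k+r≤D*D {D = zero} _ r<d d≤D with () ← ≤-trans r<d d≤D
1+k+r≤D*D {k} {r} {d} {suc D} k≤ r<d d≤D = begin
  suc (k + r)   ≡⟨ +-suc k r ⟨
  k + suc r     ≤⟨ +-mono-≤ k≤ r<d ⟩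
  d * D + d     ≡⟨ trans (*-suc d D) (+-comm d (d * D)) ⟨
  d * suc D     ≤⟨ *-monoˡ-≤ (suc D) d≤D ⟩
  suc D * suc D ∎
  where open ≤-Reasoning

D*D≤D*D*[D+1]/2 : ∀ D → D * D ≤ (D * D * (D + 1)) / 2
D*D≤D*D*[D+1]/2 zero    = z≤n
D*D≤D*D*[D+1]/2 (suc D) = begin
  suc D * suc D                   ≡⟨ m*n/n≡m (suc D * suc D) 2 ⟨
  suc D * suc D * 2 / 2           ≤⟨ /-monoˡ-≤ 2 (*-monoʳ-≤ (suc D * suc D) (s≤s (m≤n+m 1 D))) ⟩
  suc D * suc D * (suc D + 1) / 2 ∎
  where open ≤-Reasoning

deleteX₀ : ∀ {m n} → BipGraph (suc m) n → BipGraph m n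
deleteX₀ G = record { adj = adj G ∘ suc }

intervalRow : ∀ {n} → ℕ → (Fin n → Bool) → Fin n → ℕ
intervalRow k p y = suc (k + rank p y)

intervalRow-injective : ∀ {n} k (p : Fin n → Bool) {y₁ y₂} → p y₁ ≡ true → p y₂ ≡ true →
                        intervalRow k p y₁ ≡ intervalRow k p y₂ → y₁ ≡ y₂
intervalRow-injective k p py₁ py₂ eq =
  rank-injective p py₁ py₂ (+-cancelˡ-≡ k _ _ (suc-injective eq))

intervalRow-interval : ∀ {n} k (p : Fin n → Bool) {y₁ y₂ j} → p y₁ ≡ true → p y₂ ≡ true →
                       intervalRow k p y₁ ≤ j → j ≤ intervalRow k p y₂ →
                       ∃[ y ] (p y ≡ true × intervalRow k p y ≡ j)
intervalRow-interval k p {y₁} {y₂} {j} py₁ py₂ lo hi =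
  shift (rank-surjective p (j ∸ suc k) (≤-<-trans offset≤ (rank<count p y₂ py₂)))
  where
  offset≤ : j ∸ suc k ≤ rank p y₂
  offset≤ = ≤-trans (∸-monoˡ-≤ (suc k) hi) (≤-reflexive (m+n∸m≡n (suc k) (rank p y₂)))
  shift : ∃[ y ] (p y ≡ true × rank p y ≡ j ∸ suc k) →
          ∃[ y ] (p y ≡ true × intervalRow k p y ≡ j)
  shift (y , py , rank≡) =
    y , py , trans (cong (suc k +_) rank≡) (m+[n∸m]≡n (≤-trans (m≤m+n (suc k) _) lo))

IsXIntervalColoring-∷ :
  ∀ {m n} {G : BipGraph (suc m) n} {t} {c₀ : Fin n → ℕ} {c : Fin m → Fin n → ℕ} →
  IsXIntervalColoring (deleteX₀ G) t c →
  (∀ y → Edge G zero y → 1 ≤ c₀ y × c₀ y ≤ t) →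
  (∀ y₁ y₂ → Edge G zero y₁ → Edge G zero y₂ → y₁ ≢ y₂ → c₀ y₁ ≢ c₀ y₂) →
  (∀ y₁ y₂ k → Edge G zero y₁ → Edge G zero y₂ → c₀ y₁ ≤ k → k ≤ c₀ y₂ →
    ∃[ y ] (Edge G zero y × c₀ y ≡ k)) →
  (∀ x y → Edge G zero y → Edge G (suc x) y → c₀ y ≢ c x y) →
  IsXIntervalColoring G t (c₀ ∷ c)
IsXIntervalColoring-∷ {G = G} {c₀ = c₀} {c} col inRange₀ properX₀ intervalX₀ fresh = record
  { inRange   = λ { zero → inRange₀ ; (suc x) → inRange x }
  ; properX   = λ { zero → properX₀ ; (suc x) → properX x }
  ; properY   = properY′
  ; intervalX = λ { zero → intervalX₀ ; (suc x) → intervalX x }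
  }
  where
  open IsXIntervalColoring col
  properY′ : ∀ y x₁ x₂ → Edge G x₁ y → Edge G x₂ y → x₁ ≢ x₂ → (c₀ ∷ c) x₁ y ≢ (c₀ ∷ c) x₂ y
  properY′ y zero     zero     _  _  x₁≢x₂ = ⊥-elim (x₁≢x₂ refl)
  properY′ y zero     (suc x₂) e₁ e₂ _     = fresh x₂ y e₁ e₂
  properY′ y (suc x₁) zero     e₁ e₂ _     = fresh x₁ y e₂ e₁ ∘ sym
  properY′ y (suc x₁) (suc x₂) e₁ e₂ x₁≢x₂ = properY y x₁ x₂ e₁ e₂ (x₁≢x₂ ∘ cong suc)

-- intervalRow k (adj G zero) y ≡ c x y forces k to be the entry for x listed here.
clashOffsetsAt : ∀ {m n} → BipGraph (suc m) n → (Fin m → Fin n → ℕ) → Fin n → List ℕ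
clashOffsetsAt G c y =
  concat (tabulate λ x → if adj G (suc x) y then [ c x y ∸ suc (rank (adj G zero) y) ] else [])

clashOffsets : ∀ {m n} → BipGraph (suc m) n → (Fin m → Fin n → ℕ) → List ℕ
clashOffsets G c = concat (tabulate λ y → if adj G zero y then clashOffsetsAt G c y else [])

∉clashOffsets⇒fresh : ∀ {m n} (G : BipGraph (suc m) n) c {k} → k ∉ clashOffsets G c →
                     ∀ x y → Edge G zero y → Edge G (suc x) y →
                     intervalRow k (adj G zero) y ≢ c x y
∉clashOffsets⇒fresh G c {k} k∉ x y e₀ eₓ clash = k∉ (subst (_∈ clashOffsets G c) k≡ k∈)
  where
  r = rank (adj G zero) y
  k≡ : c x y ∸ suc r ≡ k
  k≡ = begin
    c x y ∸ suc r       ≡⟨ cong (_∸ suc r) clash ⟨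
    suc (k + r) ∸ suc r ≡⟨ cong (_∸ suc r) (+-suc k r) ⟨
    k + suc r ∸ suc r   ≡⟨ m+n∸n≡m k (suc r) ⟩
    k                   ∎
    where open ≡-Reasoning
  k∈ : c x y ∸ suc r ∈ clashOffsets G c
  k∈ = ∈-concat⁺′ (∈-if-true e₀ (∈-concat⁺′ (∈-if-true eₓ (here refl)) (∈-tabulate⁺ x)))
                  (∈-tabulate⁺ y)

length-clashOffsets : ∀ {m n} (G : BipGraph (suc m) n) c {D} → (∀ y → degY G y ≤ D) →
                      length (clashOffsets G c) ≤ degX G zero * (D ∸ 1)
length-clashOffsets G c {D} degY≤D = length-concat-if-≤ (adj G zero) _ commonNeighbours
  where
  commonNeighbours : ∀ y → Edge G zero y → length (clashOffsetsAt G c y) ≤ D ∸ 1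
  commonNeighbours y e₀ = begin
    length (clashOffsetsAt G c y)
      ≤⟨ length-concat-if-≤ (λ x → adj G (suc x) y) _ (λ _ _ → ≤-refl) ⟩
    degY (deleteX₀ G) y * 1 ≡⟨ *-identityʳ _ ⟩
    degY (deleteX₀ G) y     ≡⟨ cong pred (count-suc-true (λ x → adj G x y) e₀) ⟩
    degY G y ∸ 1            ≤⟨ ∸-monoˡ-≤ 1 (degY≤D y) ⟩
    D ∸ 1                   ∎
    where open ≤-Reasoning

hasXIntervalColoring-D*D : ∀ {m n} D (G : BipGraph m n) →
                           (∀ x → degX G x ≤ D) → (∀ y → degY G y ≤ D) →
                           HasXIntervalColoring G (D * D)
hasXIntervalColoring-D*D {zero} D G _ _ = (λ ()) , record
  { inRange = λ () ; properX = λ () ; properY = λ _ () ; intervalX = λ () }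
hasXIntervalColoring-D*D {suc m} D G degX≤D degY≤D
  with c , col ← hasXIntervalColoring-D*D D (deleteX₀ G) (degX≤D ∘ suc)
                   (λ y → ≤-trans (count-suc-≤ (λ x → adj G x y)) (degY≤D y))
  with k , k≤ , k∉ ← ∃-∉-≤length (clashOffsets G c) =
  intervalRow k p ∷ c , IsXIntervalColoring-∷ col
    (λ y e → s≤s z≤n , top≤D*D y e)
    (λ y₁ y₂ e₁ e₂ y₁≢y₂ → y₁≢y₂ ∘ intervalRow-injective k p e₁ e₂)
    (λ y₁ y₂ j → intervalRow-interval k p)
    (∉clashOffsets⇒fresh G c k∉)
  where
  p = adj G zero
  top≤D*D : ∀ y → Edge G zero y → intervalRow k p y ≤ D * D
  top≤D*D y e =
    1+k+r≤D*D (≤-trans k≤ (length-clashOffsets G c degY≤D)) (rank<count p y e) (degX≤D zero)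

theorem2p4 : ∀ {m n : ℕ} (G : BipGraph m n) →
    χ'int≤ G ((Δ G * Δ G * (Δ G + 1)) / 2)
theorem2p4 G =
  Δ G * Δ G , D*D≤D*D*[D+1]/2 (Δ G) , hasXIntervalColoring-D*D (Δ G) G (degX≤Δ G) (degY≤Δ G)
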